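{- Let $I$ and $J$ be two conserved intervals of $\mathcal{P}$. If there exists an element $f\in F_I\cap F_J$, then $\mathrm{Container}(I)=\mathrm{Container}(J)$.
   Context: Let $n\ge 2$, $K\ge1$, and let $\mathcal{P}=\{P_1,\ldots,P_K\}$ be a set of signed permutations of $\{1,\ldots,n\}$: each $P_k$ is a sequence in which each of $1,\ldots,n$ appears exactly once, with a sign $+$ or $-$. Assume each $P_k$ begins with $+1$ and ends with $+n$, and $P_1=\mathrm{Id}_n$ (identity order, all signs $+$). For $i\le j$, $(i..j)=\{i,\ldots,j\}$. A conserved interval of $\mathcal{P}$ is either a singleton, or a set $(a..c)$ with $a<c$ such that in every $P_k$ the elements of $(a..c)$ (ignoring signs) occupy consecutive positions and this block is delimited either by $+a$ on the left and $+c$ on the right, or by $-c$ on the left and $-a$ on the right. Intervals $(i..j)$ and $(k..l)$ overlap if $i<k\le j<l$ or $k<i\le l<j$. A conserved interval is strong if it has at least two elements and overlaps no conserved interval. For a conserved interval $I=(a..c)$, a set $\{f_1,\ldots,f_k\}$ with $a=f_1<\cdots<f_k=c$ is a set of frontiers of $I$ if $(f_i..f_j)$ is conserved for all $1\le i<j\le k$; every conserved interval $I$ has a unique inclusion-maximal set of frontiers, denoted $F_I$. $\mathrm{Container}(I)$ is the smallest strong conserved interval containing $I$. -}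

module Defs where

open import Data.Nat using (ℕ; zero; suc; _+_; _∸_; _≤_; _<_)
open import Data.Fin using (Fin; toℕ)
open import Data.List using (List; []; _∷_; _++_; map; upTo)
open import Data.Product using (_×_; _,_; proj₂; ∃; ∃-syntax)
open import Data.Sum using (_⊎_)
open import Data.Empty using (⊥)
open import Relation.Nullary using (¬_)
open import Relation.Binary.PropositionalEquality using (_≡_)
open import Data.List.Relation.Binary.Permutation.Propositional using (_↭_)

data Sign : Set where
  ⊕ ⊖ : Sign

SElem : Set
SElem = Sign × ℕ

SPerm : Set
SPerm = List SElem

ival : ℕ → ℕ → List ℕ
ival a c = map (a +_) (upTo (suc (c ∸ a)))

range1 : ℕ → List ℕ
range1 n = map suc (upTo n)

IsSignedPerm : ℕ → SPerm → Set
IsSignedPerm n P = map proj₂ P ↭ range1 n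

FramedBy : ℕ → SPerm → Set
FramedBy n P = ∃[ M ] P ≡ (⊕ , 1) ∷ M ++ (⊕ , n) ∷ []

Id : ℕ → SPerm
Id n = map (λ x → (⊕ , x)) (range1 n)

ConservedIn : SPerm → ℕ → ℕ → Set
ConservedIn P a c =
  ∃[ L ] ∃[ B ] ∃[ R ]
    (P ≡ L ++ B ++ R) × (map proj₂ B ↭ ival a c) ×
    ((∃[ M ] B ≡ (⊕ , a) ∷ M ++ (⊕ , c) ∷ []) ⊎ (∃[ M ] B ≡ (⊖ , c) ∷ M ++ (⊖ , a) ∷ []))

Conserved : (n K : ℕ) → (Fin K → SPerm) → ℕ → ℕ → Set
Conserved n K P a c =
  (a ≡ c × 1 ≤ a × a ≤ n) ⊎ (a < c × (∀ k → ConservedIn (P k) a c))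

Overlap : ℕ → ℕ → ℕ → ℕ → Set
Overlap i j k l = (i < k × k ≤ j × j < l) ⊎ (k < i × i ≤ l × l < j)

Strong : (n K : ℕ) → (Fin K → SPerm) → ℕ → ℕ → Set
Strong n K P a c =
  Conserved n K P a c × a < c ×
  (∀ i j → Conserved n K P i j → ¬ Overlap a c i j)

_⊑_ : ℕ × ℕ → ℕ × ℕ → Set
(a , c) ⊑ (a' , c') = a' ≤ a × c ≤ c'

IsFrontierSet : (n K : ℕ) → (Fin K → SPerm) → ℕ → ℕ → (ℕ → Set) → Set
IsFrontierSet n K P a c F =
  F a × F c × (∀ x → F x → a ≤ x × x ≤ c) ×
  (∀ x y → F x → F y → x < y → Conserved n K P x y)

IsMaxFrontierSet : (n K : ℕ) → (Fin K → SPerm) → ℕ → ℕ → (ℕ → Set) → Set₁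
IsMaxFrontierSet n K P a c F =
  IsFrontierSet n K P a c F ×
  (∀ (G : ℕ → Set) → IsFrontierSet n K P a c G → (∀ x → F x → G x) → ∀ x → G x → F x)

IsContainer : (n K : ℕ) → (Fin K → SPerm) → ℕ × ℕ → ℕ × ℕ → Set
IsContainer n K P I (a' , c') =
  Strong n K P a' c' × I ⊑ (a' , c') ×
  (∀ a'' c'' → Strong n K P a'' c'' → I ⊑ (a'' , c'') → (a' , c') ⊑ (a'' , c''))

-- Let (p..q) = Container(I) and let f be a common frontier of I and J = (c..d).  Since
-- p ≤ f ≤ q, the only way J could stick out of (p..q), say on the left (c < p), is through
-- the conserved interval (c..f).  If f < q, then (c..f) overlaps the strong interval (p..q).
-- If f = q, then (c..q) and (p..q) are both conserved, hence so is (c..p): in every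
-- permutation the block of (p..q) is the tail of the block of (c..q), and what precedes it
-- is a block of (c..p).  But (c..p) overlaps (p..q) as well.  So J ⊑ Container(I), whence
-- Container(J) ⊑ Container(I) by minimality, and symmetrically.
module Submission where

open import Defs
open import Data.Nat using (ℕ; suc; _+_; _∸_; _≤_; _<_; s≤s; _≤‴_; ≤‴-refl; ≤‴-step)
open import Data.Nat.Properties
  using ( suc-injective; +-identityʳ; +-suc; +-∸-assoc; n∸n≡0; m+[n∸m]≡n; ∸-monoˡ-≤
        ; ≤-refl; ≤-trans; ≤-antisym; <-trans; <⇒≤; <⇒≢; <-≤-trans; ≤-<-trans; ≮⇒≥
        ; ≤‴⇒≤; ≤⇒≤‴; m≤n⇒m<n∨m≡n )
open import Data.Fin using (Fin; toℕ)
open import Data.Product using (_×_; _,_; proj₁; proj₂; ∃-syntax; map₁)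
open import Data.Sum using (_⊎_; inj₁; inj₂)
open import Data.Empty using (⊥-elim)
open import Data.List using (List; []; _∷_; _++_; map; reverse; upTo; applyUpTo)
open import Data.List.Properties
  using ( map-++; map-∘; map-upTo; map-cong; map-id; ++-assoc; ++-cancelˡ; ++-cancelʳ
        ; ∷-injective; ∷-injectiveʳ; reverse-++; reverse-map; reverse-involutive )
open import Data.List.Relation.Unary.Any using (here; there)
open import Data.List.Membership.Propositional using (_∈_)
open import Data.List.Membership.Propositional.Properties
  using (∈-map⁺; ∈-++⁺ʳ; ∈-++⁻; ∈-upTo⁺)
open import Data.List.Relation.Unary.Unique.Propositional using (Unique; _∷_)
open import Data.List.Relation.Unary.Unique.Propositional.Properties using (Unique[x∷xs]⇒x∉xs)
import Data.List.Relation.Unary.Unique.Propositional.Properties as Unique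
open import Data.List.Relation.Binary.Permutation.Propositional
  using (_↭_; ↭-sym; ↭-trans; prep; ↭⇒↭ₛ)
open import Data.List.Relation.Binary.Permutation.Propositional.Properties
  using (drop-∷; ++⁺ˡ; ++⁺ʳ; ++-comm; ∈-resp-↭; ↭-reverse)
open import Data.List.Relation.Binary.Permutation.Setoid.Properties using (Unique-resp-↭)
open import Relation.Nullary using (¬_)
open import Function using (_∘_; id)
open import Relation.Binary.PropositionalEquality
open ≡-Reasoning

vals : SPerm → List ℕ
vals = map proj₂

signedPerm-unique : ∀ {n P} → IsSignedPerm n P → Unique (vals P)
signedPerm-unique {n} σ =
  Unique-resp-↭ (setoid ℕ) (↭⇒↭ₛ (↭-sym σ)) (Unique.map⁺ suc-injective (Unique.upTo⁺ n))

∈-vals : ∀ {x} A s C → x ∈ vals (A ++ (s , x) ∷ C)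
∈-vals A s C = ∈-map⁺ proj₂ (∈-++⁺ʳ A (here refl))

record Occurrence (P : SPerm) (x : ℕ) : Set where
  constructor occurrence
  field
    before : SPerm
    sign   : Sign
    after  : SPerm
    split  : P ≡ before ++ (sign , x) ∷ after

open Occurrence

occurrence-unique : ∀ {P x} → Unique (vals P) → (o o′ : Occurrence P x) →
                    before o ≡ before o′ × sign o ≡ sign o′ × after o ≡ after o′
occurrence-unique u (occurrence A s C refl) (occurrence A′ s′ C′ eq) = go A C A′ C′ u eq
  where
  go : ∀ {x s s′} A C A′ C′ → Unique (vals (A ++ (s , x) ∷ C)) →
       A ++ (s , x) ∷ C ≡ A′ ++ (s′ , x) ∷ C′ → A ≡ A′ × s ≡ s′ × C ≡ C′
  go [] C [] C′ _ refl = refl , refl , refl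
  go [] C (_ ∷ A′) C′ u refl = ⊥-elim (Unique[x∷xs]⇒x∉xs u (∈-vals A′ _ C′))
  go (_ ∷ A) C [] C′ u refl = ⊥-elim (Unique[x∷xs]⇒x∉xs u (∈-vals A _ C))
  go (_ ∷ A) C (_ ∷ A′) C′ (_ ∷ u) eq
    with refl , eq′ ← ∷-injective eq
    with refl , refl , refl ← go A C A′ C′ u eq′ = refl , refl , refl

ival-refl : ∀ a → ival a a ≡ a ∷ []
ival-refl a =
  trans (cong (λ k → map (a +_) (upTo (suc k))) (n∸n≡0 a)) (cong (_∷ []) (+-identityʳ a))

ival-step : ∀ {a c} → a < c → ival a c ≡ a ∷ ival (suc a) c
ival-step {a} {c} a<c = begin
  map (a +_) (upTo (suc (c ∸ a)))            ≡⟨ cong (λ k → map (a +_) (upTo (suc k))) (+-∸-assoc 1 a<c) ⟩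
  a + 0 ∷ map (a +_) (applyUpTo suc (suc k)) ≡⟨ cong₂ _∷_ (+-identityʳ a) (shift (suc k)) ⟩
  a ∷ map (suc a +_) (upTo (suc k))          ∎
  where
  k = c ∸ suc a
  shift : ∀ m → map (a +_) (applyUpTo suc m) ≡ map (suc a +_) (upTo m)
  shift m = begin
    map (a +_) (applyUpTo suc m)   ≡⟨ cong (map (a +_)) (map-upTo suc m) ⟨
    map (a +_) (map suc (upTo m))  ≡⟨ map-∘ (upTo m) ⟨
    map (λ i → a + suc i) (upTo m) ≡⟨ map-cong (+-suc a) (upTo m) ⟩
    map (suc a +_) (upTo m)        ∎

ival-++ : ∀ {a b c} → a ≤ b → b < c → ival a c ≡ ival a b ++ ival (suc b) c
ival-++ a≤b = go (≤⇒≤‴ a≤b)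
  where
  go : ∀ {a b c} → a ≤‴ b → b < c → ival a c ≡ ival a b ++ ival (suc b) c
  go {a} {_} {c} ≤‴-refl a<c = begin
    ival a c                   ≡⟨ ival-step a<c ⟩
    a ∷ ival (suc a) c         ≡⟨ cong (_++ ival (suc a) c) (ival-refl a) ⟨
    ival a a ++ ival (suc a) c ∎
  go {a} {b} {c} (≤‴-step a<‴b) b<c = begin
    ival a c                             ≡⟨ ival-step (<-≤-trans a<b (<⇒≤ b<c)) ⟩
    a ∷ ival (suc a) c                   ≡⟨ cong (a ∷_) (go a<‴b b<c) ⟩
    a ∷ ival (suc a) b ++ ival (suc b) c ≡⟨ cong (_++ ival (suc b) c) (ival-step a<b) ⟨
    ival a b ++ ival (suc b) c           ∎
    where a<b = ≤‴⇒≤ a<‴b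

∈-ival : ∀ {a x c} → a ≤ x → x ≤ c → x ∈ ival a c
∈-ival {a} a≤x x≤c =
  subst (_∈ _) (m+[n∸m]≡n a≤x) (∈-map⁺ (a +_) (∈-upTo⁺ (s≤s (∸-monoˡ-≤ a x≤c))))

↭-cancelˡ : ∀ {A : Set} (xs : List A) {ys zs} → xs ++ ys ↭ xs ++ zs → ys ↭ zs
↭-cancelˡ []       p = p
↭-cancelˡ (x ∷ xs) p = ↭-cancelˡ xs (drop-∷ p)

↭-cancelʳ : ∀ {A : Set} (zs : List A) {xs ys} → xs ++ zs ↭ ys ++ zs → xs ↭ ys
↭-cancelʳ zs {xs} {ys} p = ↭-cancelˡ zs (↭-trans (++-comm zs xs) (↭-trans p (++-comm ys zs)))

ival-cancelʳ : ∀ {c p q us vs} → c ≤ p → p < q →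
               us ++ vs ↭ ival c q → p ∷ vs ↭ ival p q → us ↭ ival c p
ival-cancelʳ {c} {p} {q} {us} {vs} c≤p p<q whole tail =
  ↭-cancelʳ (ival (suc p) q)
    (↭-trans (++⁺ˡ us (↭-sym vs↭)) (subst (us ++ vs ↭_) (ival-++ c≤p p<q) whole))
  where
  vs↭ : vs ↭ ival (suc p) q
  vs↭ = drop-∷ (subst (p ∷ vs ↭_) (ival-step p<q) tail)

ival-cancelˡ : ∀ {p q d us vs} → p ≤ q → q < d →
               us ++ vs ↭ ival p d → us ↭ ival p q → q ∷ vs ↭ ival q d
ival-cancelˡ {p} {q} {d} {us} {vs} p≤q q<d whole init =
  subst (q ∷ vs ↭_) (sym (ival-step q<d)) (prep q vs↭)
  where
  vs↭ : vs ↭ ival (suc q) d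
  vs↭ = ↭-cancelˡ (ival p q)
    (↭-trans (++⁺ʳ vs (↭-sym init)) (subst (us ++ vs ↭_) (ival-++ p≤q q<d) whole))

opposite : Sign → Sign
opposite ⊕ = ⊖
opposite ⊖ = ⊕

negate : SElem → SElem
negate = map₁ opposite

negate-involutive : ∀ e → negate (negate e) ≡ e
negate-involutive (⊕ , _) = refl
negate-involutive (⊖ , _) = refl

-- Reading a signed permutation backwards: a block +a … +c becomes −c … −a and vice versa.
flip : SPerm → SPerm
flip P = reverse (map negate P)

flip-++ : ∀ xs ys → flip (xs ++ ys) ≡ flip ys ++ flip xs
flip-++ xs ys =
  trans (cong reverse (map-++ negate xs ys)) (reverse-++ (map negate xs) (map negate ys))

flip-involutive : ∀ P → flip (flip P) ≡ P
flip-involutive P = begin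
  reverse (map negate (reverse (map negate P))) ≡⟨ cong reverse (reverse-map negate (map negate P)) ⟩
  reverse (reverse (map negate (map negate P))) ≡⟨ reverse-involutive _ ⟩
  map negate (map negate P)                     ≡⟨ map-∘ P ⟨
  map (negate ∘ negate) P                       ≡⟨ map-cong negate-involutive P ⟩
  map id P                                      ≡⟨ map-id P ⟩
  P                                             ∎

vals-flip : ∀ P → vals (flip P) ↭ vals P
vals-flip P = subst (_↭ vals P) (sym vals-flip≡) (↭-reverse (vals P))
  where
  vals-flip≡ : vals (flip P) ≡ reverse (vals P)
  vals-flip≡ = trans (reverse-map proj₂ (map negate P)) (cong reverse (sym (map-∘ P)))

flip-framed : ∀ e M e′ → flip (e ∷ M ++ e′ ∷ []) ≡ negate e′ ∷ flip M ++ negate e ∷ []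
flip-framed e M e′ =
  trans (flip-++ (e ∷ []) (M ++ e′ ∷ [])) (cong (_++ negate e ∷ []) (flip-++ M (e′ ∷ [])))

flip-decomposition : ∀ L B R → flip (L ++ B ++ R) ≡ flip R ++ flip B ++ flip L
flip-decomposition L B R = begin
  flip (L ++ B ++ R)          ≡⟨ flip-++ L (B ++ R) ⟩
  flip (B ++ R) ++ flip L     ≡⟨ cong (_++ flip L) (flip-++ B R) ⟩
  (flip R ++ flip B) ++ flip L ≡⟨ ++-assoc (flip R) (flip B) (flip L) ⟩
  flip R ++ flip B ++ flip L  ∎

unique-flip : ∀ {P} → Unique (vals P) → Unique (vals (flip P))
unique-flip {P} = Unique-resp-↭ (setoid ℕ) (↭⇒↭ₛ (↭-sym (vals-flip P)))

Framed : SPerm → ℕ → ℕ → Set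
Framed B a c =
  (∃[ M ] B ≡ (⊕ , a) ∷ M ++ (⊕ , c) ∷ []) ⊎ (∃[ M ] B ≡ (⊖ , c) ∷ M ++ (⊖ , a) ∷ [])

framed-flip : ∀ {B a c} → Framed B a c → Framed (flip B) a c
framed-flip (inj₁ (M , refl)) = inj₂ (flip M , flip-framed _ M _)
framed-flip (inj₂ (M , refl)) = inj₁ (flip M , flip-framed _ M _)

conservedIn-flip : ∀ {P a c} → ConservedIn P a c → ConservedIn (flip P) a c
conservedIn-flip (L , B , R , refl , vB , framed) =
  flip R , flip B , flip L , flip-decomposition L B R , ↭-trans (vals-flip B) vB , framed-flip framed

conservedIn-unflip : ∀ {P a c} → ConservedIn (flip P) a c → ConservedIn P a c
conservedIn-unflip {P} {a} {c} C =
  subst (λ Q → ConservedIn Q a c) (flip-involutive P) (conservedIn-flip C)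

PositiveIn : SPerm → ℕ → ℕ → Set
PositiveIn P a c = ∃[ L ] ∃[ M ] ∃[ R ]
  P ≡ L ++ ((⊕ , a) ∷ M ++ (⊕ , c) ∷ []) ++ R × vals ((⊕ , a) ∷ M ++ (⊕ , c) ∷ []) ↭ ival a c

positive-or-flipped : ∀ {P a c} → ConservedIn P a c → PositiveIn P a c ⊎ PositiveIn (flip P) a c
positive-or-flipped (L , _ , R , eq , vB , inj₁ (M , refl)) = inj₁ (L , M , R , eq , vB)
positive-or-flipped (L , B , R , refl , vB , inj₂ (M , refl)) =
  inj₂ (flip R , flip M , flip L ,
        trans (flip-decomposition L B R) (cong (λ B′ → flip R ++ B′ ++ flip L) (flip-framed _ M _)) ,
        subst (_↭ _) (cong vals (flip-framed _ M _)) (↭-trans (vals-flip B) vB))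

module _ {P : SPerm} {e e′ : SElem} (L : SPerm) where

  first-of : ∀ M R → P ≡ L ++ (e ∷ M ++ e′ ∷ []) ++ R → P ≡ L ++ e ∷ (M ++ e′ ∷ R)
  first-of M R eq = trans eq (cong (λ Z → L ++ e ∷ Z) (++-assoc M (e′ ∷ []) R))

  at-first : ∀ M R → P ≡ L ++ (e ∷ M ++ e′ ∷ []) ++ R → Occurrence P (proj₂ e)
  at-first M R eq = occurrence _ _ _ (first-of M R eq)

  at-last : ∀ M R → P ≡ L ++ (e ∷ M ++ e′ ∷ []) ++ R → Occurrence P (proj₂ e′)
  at-last M R eq = occurrence _ _ _ (trans (first-of M R eq) (sym (++-assoc L (e ∷ M) (e′ ∷ R))))

  module _ {m : SElem} (X Y R : SPerm) (eq : P ≡ L ++ (e ∷ (X ++ m ∷ Y) ++ e′ ∷ []) ++ R) where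

    interior-of : P ≡ (L ++ e ∷ X) ++ m ∷ (Y ++ e′ ∷ R)
    interior-of = trans (first-of _ R eq)
      (trans (cong (λ Z → L ++ e ∷ Z) (++-assoc X (m ∷ Y) (e′ ∷ R))) (sym (++-assoc L (e ∷ X) _)))

    at-interior : Occurrence P (proj₂ m)
    at-interior = occurrence _ _ _ interior-of

    cut-after : P ≡ L ++ (e ∷ X ++ m ∷ []) ++ (Y ++ e′ ∷ R)
    cut-after = trans (first-of _ R eq)
      (cong (λ Z → L ++ e ∷ Z) (trans (++-assoc X (m ∷ Y) (e′ ∷ R)) (sym (++-assoc X (m ∷ []) _))))

    cut-before : P ≡ (L ++ e ∷ X) ++ (m ∷ Y ++ e′ ∷ []) ++ R
    cut-before = trans interior-of (cong (λ Z → (L ++ e ∷ X) ++ m ∷ Z) (sym (++-assoc Y (e′ ∷ []) R)))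

vals-cut : ∀ e X m Y e′ →
           vals (e ∷ (X ++ m ∷ Y) ++ e′ ∷ []) ≡ vals (e ∷ X ++ m ∷ []) ++ vals (Y ++ e′ ∷ [])
vals-cut e X m Y e′ =
  trans (cong (λ Z → vals (e ∷ Z)) regroup) (map-++ proj₂ (e ∷ X ++ m ∷ []) (Y ++ e′ ∷ []))
  where
  regroup : (X ++ m ∷ Y) ++ e′ ∷ [] ≡ (X ++ m ∷ []) ++ Y ++ e′ ∷ []
  regroup = trans (++-assoc X (m ∷ Y) (e′ ∷ [])) (sym (++-assoc X (m ∷ []) _))

∈-vals⇒split : ∀ {x} M → x ∈ vals M → ∃[ X ] ∃[ s ] ∃[ Y ] M ≡ X ++ (s , x) ∷ Y
∈-vals⇒split ((s , _) ∷ M) (here refl) = [] , s , M , refl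
∈-vals⇒split (e ∷ M) (there x∈) with X , s , Y , refl ← ∈-vals⇒split M x∈ = e ∷ X , s , Y , refl

interior-split : ∀ {a x c} M → a < x → x < c → vals ((⊕ , a) ∷ M ++ (⊕ , c) ∷ []) ↭ ival a c →
                 ∃[ X ] ∃[ s ] ∃[ Y ] M ≡ X ++ (s , x) ∷ Y
interior-split M a<x x<c vB with ∈-resp-↭ (↭-sym vB) (∈-ival (<⇒≤ a<x) (<⇒≤ x<c))
... | here x≡a = ⊥-elim (<⇒≢ a<x (sym x≡a))
... | there x∈ with ∈-++⁻ (vals M) (subst (_ ∈_) (map-++ proj₂ M _) x∈)
...   | inj₁ x∈M = ∈-vals⇒split M x∈M
...   | inj₂ (here x≡c) = ⊥-elim (<⇒≢ x<c x≡c)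

-- q occurs only once, so the blocks of (c..q) and (p..q) end at the same place with the same
-- orientation; p occurs only once, so the block of (p..q) starts where p sits inside that of (c..q).
conservedIn-dropSuffix⁺ : ∀ {P c p q} → Unique (vals P) → c < p → p < q →
                          PositiveIn P c q → ConservedIn P p q → ConservedIn P c p
conservedIn-dropSuffix⁺ {c = c} {p} {q} u c<p p<q (L , M , R , eq , vB)
                        (L′ , _ , R′ , eq′ , vB′ , framed)
  with X , _ , Y , refl ← interior-split M c<p p<q vB
  with framed
... | inj₂ (M′ , refl)
  with _ , () , _ ← occurrence-unique u (at-last L M R eq) (at-first L′ M′ R′ eq′)
... | inj₁ (M′ , refl)
  with _ , _ , refl ← occurrence-unique u (at-last L M R eq) (at-last L′ M′ R′ eq′)
  with _ , refl , tails ← occurrence-unique u (at-interior L X Y R eq) (at-first L′ M′ R eq′)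
  with refl ← ++-cancelʳ _ Y M′ tails
  = L , _ , _ , cut-after L X Y R eq ,
    ival-cancelʳ (<⇒≤ c<p) p<q (subst (_↭ ival c q) (vals-cut (⊕ , c) X (⊕ , p) Y (⊕ , q)) vB) vB′ ,
    inj₁ (X , refl)

conservedIn-dropPrefix⁺ : ∀ {P p q d} → Unique (vals P) → p < q → q < d →
                          PositiveIn P p d → ConservedIn P p q → ConservedIn P q d
conservedIn-dropPrefix⁺ {p = p} {q} {d} u p<q q<d (L , M , R , eq , vB)
                        (L′ , _ , R′ , eq′ , vB′ , framed)
  with X , _ , Y , refl ← interior-split M p<q q<d vB
  with framed
... | inj₂ (M′ , refl)
  with _ , () , _ ← occurrence-unique u (at-first L M R eq) (at-last L′ M′ R′ eq′)
... | inj₁ (M′ , refl)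
  with refl , _ , _ ← occurrence-unique u (at-first L M R eq) (at-first L′ M′ R′ eq′)
  with heads , refl , _ ← occurrence-unique u (at-interior L X Y R eq) (at-last L M′ R′ eq′)
  with refl ← ∷-injectiveʳ (++-cancelˡ L _ _ heads)
  = _ , _ , R , cut-before L X Y R eq ,
    ival-cancelˡ (<⇒≤ p<q) q<d (subst (_↭ ival p d) (vals-cut (⊕ , p) X (⊕ , q) Y (⊕ , d)) vB) vB′ ,
    inj₁ (Y , refl)

conservedIn-dropSuffix : ∀ {P c p q} → Unique (vals P) → c < p → p < q →
                         ConservedIn P c q → ConservedIn P p q → ConservedIn P c p
conservedIn-dropSuffix u c<p p<q big small with positive-or-flipped big
... | inj₁ pos = conservedIn-dropSuffix⁺ u c<p p<q pos small
... | inj₂ pos =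
  conservedIn-unflip (conservedIn-dropSuffix⁺ (unique-flip u) c<p p<q pos (conservedIn-flip small))

conservedIn-dropPrefix : ∀ {P p q d} → Unique (vals P) → p < q → q < d →
                         ConservedIn P p d → ConservedIn P p q → ConservedIn P q d
conservedIn-dropPrefix u p<q q<d big small with positive-or-flipped big
... | inj₁ pos = conservedIn-dropPrefix⁺ u p<q q<d pos small
... | inj₂ pos =
  conservedIn-unflip (conservedIn-dropPrefix⁺ (unique-flip u) p<q q<d pos (conservedIn-flip small))

conserved⇒conservedIn : ∀ {n K P x y} → Conserved n K P x y → x < y → ∀ k → ConservedIn (P k) x y
conserved⇒conservedIn (inj₁ (refl , _)) x<x = ⊥-elim (<⇒≢ x<x refl)
conserved⇒conservedIn (inj₂ (_ , conservedIn)) _ = conservedIn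

module _ {n K : ℕ} {P : Fin K → SPerm} (unique : ∀ k → Unique (vals (P k))) where

  conserved-dropSuffix : ∀ {c p q} → c < p → p < q →
                         Conserved n K P c q → Conserved n K P p q → Conserved n K P c p
  conserved-dropSuffix c<p p<q Ccq Cpq = inj₂ (c<p , λ k →
    conservedIn-dropSuffix (unique k) c<p p<q
      (conserved⇒conservedIn Ccq (<-trans c<p p<q) k) (conserved⇒conservedIn Cpq p<q k))

  conserved-dropPrefix : ∀ {p q d} → p < q → q < d →
                         Conserved n K P p d → Conserved n K P p q → Conserved n K P q d
  conserved-dropPrefix p<q q<d Cpd Cpq = inj₂ (q<d , λ k →
    conservedIn-dropPrefix (unique k) p<q q<d
      (conserved⇒conservedIn Cpd (<-trans p<q q<d) k) (conserved⇒conservedIn Cpq p<q k))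

  strong-left-bound : ∀ {p q c f} → Strong n K P p q → p ≤ f → f ≤ q →
                      (c < f → Conserved n K P c f) → p ≤ c
  strong-left-bound {p} {q} {c} {f} (Cpq , p<q , no-overlap) p≤f f≤q Ccf = ≮⇒≥ c≮p
    where
    c≮p : ¬ c < p
    c≮p c<p with m≤n⇒m<n∨m≡n f≤q
    ... | inj₁ f<q  = no-overlap c f (Ccf (<-≤-trans c<p p≤f)) (inj₂ (c<p , p≤f , f<q))
    ... | inj₂ refl = no-overlap c p (conserved-dropSuffix c<p p<q (Ccf (<-≤-trans c<p p≤f)) Cpq)
                                     (inj₂ (c<p , ≤-refl , p<q))

  strong-right-bound : ∀ {p q d f} → Strong n K P p q → p ≤ f → f ≤ q →
                       (f < d → Conserved n K P f d) → d ≤ q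
  strong-right-bound {p} {q} {d} {f} (Cpq , p<q , no-overlap) p≤f f≤q Cfd = ≮⇒≥ q≮d
    where
    q≮d : ¬ q < d
    q≮d q<d with m≤n⇒m<n∨m≡n p≤f
    ... | inj₁ p<f  = no-overlap f d (Cfd (≤-<-trans f≤q q<d)) (inj₁ (p<f , f≤q , q<d))
    ... | inj₂ refl = no-overlap q d (conserved-dropPrefix p<q q<d (Cfd (≤-<-trans f≤q q<d)) Cpq)
                                     (inj₁ (p<q , ≤-refl , q<d))

  shared-frontier⇒⊑ : ∀ {a b c d p q f FI FJ} → Strong n K P p q → (a , b) ⊑ (p , q) →
                      IsFrontierSet n K P a b FI → IsFrontierSet n K P c d FJ → FI f → FJ f →
                      (c , d) ⊑ (p , q)
  shared-frontier⇒⊑ {p = p} {q} {f} S (p≤a , b≤q) (_ , _ , FI⊆ , _) (Fc , Fd , _ , FJ-conserved)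
                    fI fJ =
    strong-left-bound S p≤f f≤q (FJ-conserved _ _ Fc fJ) ,
    strong-right-bound S p≤f f≤q (FJ-conserved _ _ fJ Fd)
    where
    p≤f : p ≤ f
    p≤f = ≤-trans p≤a (proj₁ (FI⊆ f fI))
    f≤q : f ≤ q
    f≤q = ≤-trans (proj₂ (FI⊆ f fI)) b≤q

⊑-antisym : ∀ {I J} → I ⊑ J → J ⊑ I → I ≡ J
⊑-antisym (a′≤a , c≤c′) (a≤a′ , c′≤c) =
  cong₂ _,_ (≤-antisym a≤a′ a′≤a) (≤-antisym c≤c′ c′≤c)

lemma8 : (n K : ℕ) → 2 ≤ n → 1 ≤ K → (P : Fin K → SPerm) →
         (∀ k → IsSignedPerm n (P k)) → (∀ k → FramedBy n (P k)) →
         (∀ k → toℕ k ≡ 0 → P k ≡ Id n) →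
         (a b c d : ℕ) → Conserved n K P a b → Conserved n K P c d →
         (FI FJ : ℕ → Set) → IsMaxFrontierSet n K P a b FI → IsMaxFrontierSet n K P c d FJ →
         (f : ℕ) → FI f → FJ f →
         (CI CJ : ℕ × ℕ) → IsContainer n K P (a , b) CI → IsContainer n K P (c , d) CJ →
         CI ≡ CJ
lemma8 n K _ _ P signed _ _ a b c d _ _ FI FJ (FI-frontiers , _) (FJ-frontiers , _) f fI fJ
       (p , q) (p′ , q′) (SI , I⊑CI , CI-least) (SJ , J⊑CJ , CJ-least) =
  ⊑-antisym (CI-least p′ q′ SJ I⊑CJ) (CJ-least p q SI J⊑CI)
  where
  unique : ∀ k → Unique (vals (P k))
  unique k = signedPerm-unique (signed k)

  J⊑CI : (c , d) ⊑ (p , q)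
  J⊑CI = shared-frontier⇒⊑ unique SI I⊑CI FI-frontiers FJ-frontiers fI fJ

  I⊑CJ : (a , b) ⊑ (p′ , q′)
  I⊑CJ = shared-frontier⇒⊑ unique SJ J⊑CJ FJ-frontiers FI-frontiers fJ fI
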